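{- Let $N$ be a positive even integer, let $g$ be a positive even integer, and let $q$ be a prime with $q\nmid g$. Then $$\sum_{j\ge1} w_{g,j}(qN)=\sum_{j\ge1} w_{g,j}(N).$$
   Context: For a positive integer $N$, let $1=u_0<\dots<u_{\varphi(N)}=N+1$ be the integers in $[1,N+1]$ coprime to $N$, and $\mathcal{G}(N)=(g_1,\dots,g_{\varphi(N)})$, $g_i=u_i-u_{i-1}$, indices cyclic mod $\varphi(N)$. For $j\ge1$, $n_{g,j}(N)$ is the number of positions $i\in\{1,\dots,\varphi(N)\}$ with $g_i+\dots+g_{i+j-1}=g$ (driving terms of length $j$ for the gap $g$), and $w_{g,j}(N)=n_{g,j}(N)/n_{2,1}(N)$. -}

module Defs where

open import Data.Nat using (ℕ; zero; suc; _+_; _≟_; NonZero)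
open import Data.Nat.DivMod using (_%_)
open import Data.Nat.Coprimality using (coprime?)
open import Data.List using (List; []; _∷_; filter; length; map; upTo; zipWith; foldr)
open import Data.Nat.ListAction using (sum)
open import Data.Integer using (+_)
open import Data.Rational using (ℚ; 0ℚ; _/_) renaming (_+_ to _+ℚ_)

-- u_0 < ... < u_φ : integers in [1, N+1] coprime to N
coprimeList : ℕ → List ℕ
coprimeList N = filter (λ u → coprime? u N) (map suc (upTo (suc N)))

diffs : List ℕ → List ℕ
diffs []       = []
diffs (x ∷ xs) = zipWith (λ b a → b Data.Nat.∸ a) xs (x ∷ xs)

-- 𝒢(N) = (g_1,…,g_φ(N)) as a list (list index k holds g_{k+1})
gaps : ℕ → List ℕ
gaps N = diffs (coprimeList N)

φ' : ℕ → ℕ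
φ' N = length (gaps N)

nth : List ℕ → ℕ → ℕ
nth []       _       = 0
nth (x ∷ xs) zero    = x
nth (x ∷ xs) (suc k) = nth xs k

modOr : ℕ → ℕ → ℕ
modOr i zero    = i
modOr i (suc m) = i % suc m

-- cyclic gap: gapAt N k = g_{k+1}, indices mod φ(N)
gapAt : ℕ → ℕ → ℕ
gapAt N k = nth (gaps N) (modOr k (φ' N))

-- g_i + … + g_{i+j-1}, with 0-based start position i (i.e. position i+1)
windowSum : ℕ → ℕ → ℕ → ℕ
windowSum N i j = sum (map (λ k → gapAt N (i + k)) (upTo j))

nCount : ℕ → ℕ → ℕ → ℕ
nCount g j N = length (filter (λ i → windowSum N i j ≟ g) (upTo (φ' N)))

-- w_{g,j}(N) = n_{g,j}(N) / n_{2,1}(N)  (set to 0 when n_{2,1}(N) = 0,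
-- which never happens for even N ≥ 2)
wRatio : ℕ → ℕ → ℕ → ℚ
wRatio g j N with nCount 2 1 N
... | zero  = 0ℚ
... | suc d = (+ nCount g j N) / suc d

-- ∑_{j≥1} w_{g,j}(N); since every gap is ≥ 1, terms with j > g vanish,
-- so the sum is over j = 1,…,g
wTotal : ℕ → ℕ → ℚ
wTotal g N = foldr _+ℚ_ 0ℚ (map (λ j → wRatio g (suc j) N) (upTo g))

{-# OPTIONS --safe #-}
-- Continue u_0 < … < u_φ to the increasing enumeration u of all positive integers
-- coprime to N, so that g_{i+1} + … + g_{i+j} = u_{i+j} − u_i.  As u is strictly
-- increasing, for fixed i at most one j has u_{i+j} = u_i + g; such a j is ≤ g, and it
-- exists iff u_i + g is coprime to N.  Hence ∑_j n_{g,j}(N) counts the x ∈ [1, N] with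
-- x and x + g both coprime to N; for even N every gap is ≥ 2, so the same count with
-- g = 2 is n_{2,1}(N).  Writing x ∈ [1, qN] as a + tN with t < q, x and x + g are
-- coprime to qN iff a and a + g are coprime to N and q divides neither x nor x + g.
-- If q ∣ N the last condition is automatic; otherwise, as q ∤ g, it excludes exactly
-- two of the q values of t.  So ∑_j n_{g,j} and n_{2,1} scale by the same factor,
-- q or q − 2, and q − 2 > 0 because q ∤ N forces q ≠ 2.
module Submission where

open import Defs
open import Data.Nat using (ℕ; zero; suc; _+_; _*_; _∸_; _<_; _≤_; _≟_; z≤n; s≤s; NonZero; >-nonZero; nonTrivial⇒n>1)
open import Data.Nat.Properties
open import Data.Nat.Divisibility using (_∣_; _∣?_; divides; ∣-trans; ∣n⇒∣m*n; m∣m*n; n∣m*n; ∣m∣n⇒∣m+n; ∣m+n∣m⇒∣n; ∣⇒≤)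
open import Data.Nat.Primality using (Prime; prime[2]; prime⇒nonZero; prime⇒nonTrivial; prime⇒irreducible)
open import Data.Nat.Coprimality using (Coprime; coprime?; coprime-divisor; coprime-Bézout; coprime-+; 1-coprimeTo) renaming (sym to coprime-sym)
open import Data.Nat.GCD using (module Bézout)
open import Data.Nat.DivMod using (_%_; _/_; m%n<n; m≡m%n+[m/n]*n; [m+n]%n≡m%n; m<n⇒m%n≡m)
open import Data.Nat.Solver using (module +-*-Solver)
open import Data.List using ([]; _∷_; filter; length; map; foldr; upTo; _++_; [_])
open import Data.List.Properties using (upTo-∷ʳ; map-++; filter-accept; map-upTo; map-∘; map-cong)
open import Data.List.Membership.Propositional using (_∈_)
open import Data.List.Membership.Propositional.Properties using (∈-filter⁺; ∈-filter⁻; ∈-map⁺; ∈-map⁻; ∈-upTo⁺; ∈-upTo⁻)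
open import Data.List.Relation.Unary.Any using (here; there)
import Data.List.Relation.Unary.All as All
open import Data.List.Relation.Unary.AllPairs using (AllPairs; _∷_)
import Data.List.Relation.Unary.AllPairs.Properties as AllPairs
open import Data.Nat.ListAction using (sum)
open import Data.Nat.ListAction.Properties using (sum-++)
open import Data.Product using (∃; _×_; _,_; proj₁; proj₂)
open import Data.Sum using (_⊎_; inj₁; inj₂)
open import Relation.Binary.Definitions using (tri<; tri≈; tri>)
open import Function using (_∘_; _⇔_; mk⇔; Equivalence)
open import Relation.Nullary using (¬_; ¬?; Dec; yes; no; contradiction)
open import Relation.Nullary.Decidable using (_×-dec_)
open import Level using (0ℓ)
open import Relation.Unary using (Pred; Decidable)
open import Relation.Binary.PropositionalEquality using (_≡_; _≢_; refl; sym; trans; cong; cong₂; subst; module ≡-Reasoning)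
open import Algebra.Properties.CommutativeSemigroup +-commutativeSemigroup using (interchange; xy∙z≈xz∙y; x∙yz≈xz∙y; xy∙z≈x∙zy)
open import Algebra.Properties.CommutativeSemigroup *-commutativeSemigroup using () renaming (interchange to *-interchange)
open import Data.Integer using (ℤ)
import Data.Integer as ℤ
import Data.Integer.Properties as ℤ
import Data.Integer.Solver as ℤ-Solver
open import Data.Rational using (ℚ)
import Data.Rational as ℚ
import Data.Rational.Properties as ℚ
open import Data.Rational.Unnormalised using (mkℚᵘ)
import Data.Rational.Unnormalised as ℚᵘ
import Data.Rational.Unnormalised.Properties as ℚᵘ

∑< : ℕ → (ℕ → ℕ) → ℕ
∑< zero    f = 0
∑< (suc n) f = ∑< n f + f n

syntax ∑< n (λ i → e) = ∑[ i < n ] e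

𝟙 : {P : Set} → Dec P → ℕ
𝟙 (yes _) = 1
𝟙 (no _)  = 0

𝟙-yes : {P : Set} (P? : Dec P) → P → 𝟙 P? ≡ 1
𝟙-yes (yes _) _ = refl
𝟙-yes (no ¬p) p = contradiction p ¬p

𝟙-no : {P : Set} (P? : Dec P) → ¬ P → 𝟙 P? ≡ 0
𝟙-no (yes p) ¬p = contradiction p ¬p
𝟙-no (no _)  _  = refl

𝟙-cong : {P Q : Set} (P? : Dec P) (Q? : Dec Q) → P ⇔ Q → 𝟙 P? ≡ 𝟙 Q?
𝟙-cong (yes p) Q?     P⇔Q = sym (𝟙-yes Q? (Equivalence.to P⇔Q p))
𝟙-cong (no ¬p) (yes q) P⇔Q = contradiction (Equivalence.from P⇔Q q) ¬p
𝟙-cong (no _)  (no _)  _   = refl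

𝟙-× : {P Q : Set} (P? : Dec P) (Q? : Dec Q) → 𝟙 (P? ×-dec Q?) ≡ 𝟙 P? * 𝟙 Q?
𝟙-× (yes _) (yes _) = refl
𝟙-× (yes _) (no _)  = refl
𝟙-× (no _)  _       = refl

∑-cong : ∀ n {f g : ℕ → ℕ} → (∀ i → i < n → f i ≡ g i) → ∑< n f ≡ ∑< n g
∑-cong zero    _   = refl
∑-cong (suc n) f≡g = cong₂ _+_ (∑-cong n (λ i i<n → f≡g i (m<n⇒m<1+n i<n))) (f≡g n ≤-refl)

∑-+ : ∀ n (f g : ℕ → ℕ) → ∑[ i < n ] (f i + g i) ≡ ∑< n f + ∑< n g
∑-+ zero    f g = refl
∑-+ (suc n) f g = trans (cong (_+ (f n + g n)) (∑-+ n f g)) (interchange (∑< n f) (∑< n g) (f n) (g n))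

∑-const : ∀ n c → ∑[ _ < n ] c ≡ n * c
∑-const zero    c = refl
∑-const (suc n) c = trans (cong (_+ c) (∑-const n c)) (+-comm (n * c) c)

∑-*ˡ : ∀ n c (f : ℕ → ℕ) → ∑[ i < n ] (c * f i) ≡ c * ∑< n f
∑-*ˡ zero    c f = sym (*-zeroʳ c)
∑-*ˡ (suc n) c f = trans (cong (_+ c * f n) (∑-*ˡ n c f)) (sym (*-distribˡ-+ c (∑< n f) (f n)))

∑-zero : ∀ n {f : ℕ → ℕ} → (∀ i → i < n → f i ≡ 0) → ∑< n f ≡ 0
∑-zero n f≡0 = trans (∑-cong n f≡0) (trans (∑-const n 0) (*-zeroʳ n))

∑-comm : ∀ m n (f : ℕ → ℕ → ℕ) → ∑[ j < m ] ∑[ i < n ] f i j ≡ ∑[ i < n ] ∑[ j < m ] f i j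
∑-comm zero    n f = sym (∑-zero n (λ _ _ → refl))
∑-comm (suc m) n f = trans (cong (_+ ∑[ i < n ] f i m) (∑-comm m n f)) (sym (∑-+ n _ _))

∑-split : ∀ m n (f : ℕ → ℕ) → ∑< (m + n) f ≡ ∑< m f + ∑[ r < n ] f (m + r)
∑-split m zero    f = trans (cong (λ k → ∑< k f) (+-identityʳ m)) (sym (+-identityʳ _))
∑-split m (suc n) f = begin
  ∑< (m + suc n) f                               ≡⟨ cong (λ k → ∑< k f) (+-suc m n) ⟩
  ∑< (m + n) f + f (m + n)                       ≡⟨ cong (_+ f (m + n)) (∑-split m n f) ⟩
  ∑< m f + ∑[ r < n ] f (m + r) + f (m + n)      ≡⟨ +-assoc (∑< m f) _ _ ⟩
  ∑< m f + (∑[ r < n ] f (m + r) + f (m + n))    ∎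
  where open ≡-Reasoning

∑-blocks : ∀ q n (f : ℕ → ℕ) → ∑< (q * n) f ≡ ∑[ t < q ] ∑[ r < n ] f (t * n + r)
∑-blocks zero    n f = refl
∑-blocks (suc q) n f = begin
  ∑< (n + q * n) f                                   ≡⟨ cong (λ k → ∑< k f) (+-comm n (q * n)) ⟩
  ∑< (q * n + n) f                                   ≡⟨ ∑-split (q * n) n f ⟩
  ∑< (q * n) f + ∑[ r < n ] f (q * n + r)            ≡⟨ cong (_+ ∑[ r < n ] f (q * n + r)) (∑-blocks q n f) ⟩
  ∑[ t < q ] ∑[ r < n ] f (t * n + r) + ∑[ r < n ] f (q * n + r) ∎
  where open ≡-Reasoning

∑-𝟙-unique : ∀ {P : Pred ℕ 0ℓ} (P? : Decidable P) n →
  (∀ {i j} → i < n → j < n → P i → P j → i ≡ j) →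
  ∀ {j} → j < n → P j → ∑[ i < n ] 𝟙 (P? i) ≡ 1
∑-𝟙-unique P? (suc n) unique {j} j<1+n Pj with m<1+n⇒m<n∨m≡n j<1+n
... | inj₁ j<n = cong₂ _+_
  (∑-𝟙-unique P? n (λ i<n k<n → unique (m<n⇒m<1+n i<n) (m<n⇒m<1+n k<n)) j<n Pj)
  (𝟙-no (P? n) (λ Pn → <-irrefl (unique j<1+n ≤-refl Pj Pn) j<n))
... | inj₂ refl = cong₂ _+_
  (∑-zero n (λ i i<n → 𝟙-no (P? i) (λ Pi → <-irrefl (unique (m<n⇒m<1+n i<n) ≤-refl Pi Pj) i<n)))
  (𝟙-yes (P? j) Pj)

sum-upTo : ∀ n (f : ℕ → ℕ) → sum (map f (upTo n)) ≡ ∑< n f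
sum-upTo zero    f = refl
sum-upTo (suc n) f = begin
  sum (map f (upTo (suc n)))         ≡⟨ cong (sum ∘ map f) (sym (upTo-∷ʳ n)) ⟩
  sum (map f (upTo n ++ [ n ]))      ≡⟨ cong sum (map-++ f (upTo n) [ n ]) ⟩
  sum (map f (upTo n) ++ [ f n ])    ≡⟨ sum-++ (map f (upTo n)) [ f n ] ⟩
  sum (map f (upTo n)) + (f n + 0)   ≡⟨ cong₂ _+_ (sum-upTo n f) (+-identityʳ (f n)) ⟩
  ∑< n f + f n                       ∎
  where open ≡-Reasoning

module _ {P : Pred ℕ 0ℓ} (P? : Decidable P) where

  length-filter : ∀ xs → length (filter P? xs) ≡ sum (map (λ x → 𝟙 (P? x)) xs)
  length-filter []       = refl
  length-filter (x ∷ xs) with P? x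
  ... | yes _ = cong suc (length-filter xs)
  ... | no _  = length-filter xs

  sum-map-filter : ∀ (f : ℕ → ℕ) xs → sum (map f (filter P? xs)) ≡ sum (map (λ x → 𝟙 (P? x) * f x) xs)
  sum-map-filter f []       = refl
  sum-map-filter f (x ∷ xs) with P? x
  ... | yes _ = cong₂ _+_ (sym (+-identityʳ (f x))) (sum-map-filter f xs)
  ... | no _  = sum-map-filter f xs

  length-filter-upTo : ∀ n → length (filter P? (upTo n)) ≡ ∑[ i < n ] 𝟙 (P? i)
  length-filter-upTo n = trans (length-filter (upTo n)) (sum-upTo n (λ i → 𝟙 (P? i)))

∑-nth : ∀ (f : ℕ → ℕ) xs → ∑[ i < length xs ] f (nth xs i) ≡ sum (map f xs)
∑-nth f []       = refl
∑-nth f (x ∷ xs) = trans (∑-split 1 (length xs) (f ∘ nth (x ∷ xs))) (cong (f x +_) (∑-nth f xs))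

nth-∈ : ∀ xs {k} → k < length xs → nth xs k ∈ xs
nth-∈ (x ∷ xs) {zero}  _         = here refl
nth-∈ (x ∷ xs) {suc k} (s≤s k<n) = there (nth-∈ xs k<n)

∈⇒nth : ∀ {x} xs → x ∈ xs → ∃ λ k → k < length xs × nth xs k ≡ x
∈⇒nth (x ∷ xs) (here refl) = 0 , s≤s z≤n , refl
∈⇒nth (y ∷ xs) (there x∈xs) with ∈⇒nth xs x∈xs
... | k , k<n , eq = suc k , s≤s k<n , eq

nth-sorted : ∀ {xs} → AllPairs _<_ xs → ∀ {i j} → i < j → j < length xs → nth xs i < nth xs j
nth-sorted {x ∷ xs} (x< ∷ _)  {zero}  {suc j} _         (s≤s j<n) = All.lookup x< (nth-∈ xs j<n)
nth-sorted {x ∷ xs} (_ ∷ xs<) {suc i} {suc j} (s≤s i<j) (s≤s j<n) = nth-sorted xs< i<j j<n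

nth-diffs : ∀ xs k → nth (diffs xs) k ≡ nth xs (suc k) ∸ nth xs k
nth-diffs []           k       = refl
nth-diffs (x ∷ [])     k       = sym (0∸n≡0 (nth (x ∷ []) k))
nth-diffs (x ∷ y ∷ ys) zero    = refl
nth-diffs (x ∷ y ∷ ys) (suc k) = nth-diffs (y ∷ ys) k

length-diffs : ∀ x xs → length (diffs (x ∷ xs)) ≡ length xs
length-diffs x []       = refl
length-diffs x (y ∷ ys) = cong suc (length-diffs y ys)

module StrictlyIncreasing (f : ℕ → ℕ) (f-step : ∀ m → f m < f (suc m)) where

  f-mono-< : ∀ {i j} → i < j → f i < f j
  f-mono-< {i} {suc j} i<1+j with m<1+n⇒m<n∨m≡n i<1+j
  ... | inj₁ i<j  = <-trans (f-mono-< i<j) (f-step j)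
  ... | inj₂ refl = f-step i

  f-mono-≤ : ∀ {i j} → i ≤ j → f i ≤ f j
  f-mono-≤ i≤j with m≤n⇒m<n∨m≡n i≤j
  ... | inj₁ i<j  = <⇒≤ (f-mono-< i<j)
  ... | inj₂ refl = ≤-refl

  f-injective : ∀ {i j} → f i ≡ f j → i ≡ j
  f-injective {i} {j} fi≡fj with <-cmp i j
  ... | tri< i<j _ _ = contradiction fi≡fj (<⇒≢ (f-mono-< i<j))
  ... | tri≈ _ i≡j _ = i≡j
  ... | tri> _ _ j<i = contradiction (sym fi≡fj) (<⇒≢ (f-mono-< j<i))

  f-+-≤ : ∀ i d → f i + d ≤ f (i + d)
  f-+-≤ i zero    = ≤-reflexive (trans (+-identityʳ (f i)) (cong f (sym (+-identityʳ i))))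
  f-+-≤ i (suc d) = begin
    f i + suc d        ≡⟨ +-suc (f i) d ⟩
    suc (f i + d)      ≤⟨ s≤s (f-+-≤ i d) ⟩
    suc (f (i + d))    ≤⟨ f-step (i + d) ⟩
    f (suc (i + d))    ≡⟨ cong f (sym (+-suc i d)) ⟩
    f (i + suc d)      ∎
    where open ≤-Reasoning

  ∑-hits≡𝟙-member : ∀ {P : Pred ℕ 0ℓ} (P? : Decidable P) →
    (∀ m → P (f m)) → (∀ a → f 0 ≤ a → P a → ∃ λ m → f m ≡ a) →
    ∀ i {d} → 0 < d → ∑[ j < d ] 𝟙 (f (i + suc j) ≟ f i + d) ≡ 𝟙 (P? (f i + d))
  ∑-hits≡𝟙-member {P} P? sound onto i {d} d>0 with P? (f i + d)
  ... | no ¬P = ∑-zero d (λ j _ → 𝟙-no (f (i + suc j) ≟ f i + d) (λ hit → ¬P (subst P hit (sound (i + suc j)))))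
  ... | yes P[fi+d] with onto (f i + d) (≤-trans (f-mono-≤ z≤n) (m≤m+n (f i) d)) P[fi+d]
  ...   | m , fm≡ with m≤n⇒∃[o]m+o≡n i<m
    where
    i<m : i < m
    i<m = ≰⇒> (λ m≤i → <⇒≱ (subst (f i <_) (sym fm≡) (m<m+n (f i) d>0)) (f-mono-≤ m≤i))
  ...     | j , i+1+j≡m = ∑-𝟙-unique (λ j → f (i + suc j) ≟ f i + d) d unique j<d hit
    where
    hit : f (i + suc j) ≡ f i + d
    hit = trans (cong f (trans (+-suc i j) i+1+j≡m)) fm≡
    j<d : j < d
    j<d = +-cancelˡ-≤ (f i) (suc j) d (subst (f i + suc j ≤_) hit (f-+-≤ i (suc j)))
    unique : ∀ {j j′} → j < d → j′ < d → f (i + suc j) ≡ f i + d → f (i + suc j′) ≡ f i + d → j ≡ j′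
    unique _ _ hit hit′ = suc-injective (+-cancelˡ-≡ i _ _ (f-injective (trans hit (sym hit′))))

coprime-+-*⇔ : ∀ a t n → Coprime (a + t * n) n ⇔ Coprime a n
coprime-+-*⇔ a t n = mk⇔
  (λ c {d} (d∣a , d∣n) → c (∣m∣n⇒∣m+n d∣a (∣n⇒∣m*n t d∣n) , d∣n))
  (λ c {d} (d∣a+tn , d∣n) → c (∣m+n∣m⇒∣n (subst (d ∣_) (+-comm a (t * n)) d∣a+tn) (∣n⇒∣m*n t d∣n) , d∣n))

prime>1 : ∀ {p} → Prime p → 1 < p
prime>1 {p} p-prime = nonTrivial⇒n>1 p {{prime⇒nonTrivial p-prime}}

prime∧∤⇒coprime : ∀ {p a} → Prime p → ¬ p ∣ a → Coprime p a
prime∧∤⇒coprime p-prime p∤a (d∣p , d∣a) with prime⇒irreducible p-prime d∣p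
... | inj₁ d≡1  = d≡1
... | inj₂ refl = contradiction d∣a p∤a

coprime∧∣⇒∤ : ∀ {p a n} → Prime p → p ∣ n → Coprime a n → ¬ p ∣ a
coprime∧∣⇒∤ p-prime p∣n c p∣a = <⇒≢ (prime>1 p-prime) (sym (c (p∣a , p∣n)))

coprime-*⇔ : ∀ {p a n} → Prime p → Coprime a (p * n) ⇔ (Coprime a n × ¬ p ∣ a)
coprime-*⇔ {p} {a} {n} p-prime = mk⇔ split coprime-pn
  where
  split : Coprime a (p * n) → Coprime a n × ¬ p ∣ a
  split c = (λ (d∣a , d∣n) → c (d∣a , ∣n⇒∣m*n p d∣n)) , coprime∧∣⇒∤ p-prime (m∣m*n n) c
  coprime-pn : Coprime a n × ¬ p ∣ a → Coprime a (p * n)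
  coprime-pn (c , p∤a) {d} (d∣a , d∣pn) = c (d∣a , coprime-divisor d⊥p d∣pn)
    where
    d⊥p : Coprime d p
    d⊥p (e∣d , e∣p) = prime∧∤⇒coprime p-prime p∤a (e∣p , ∣-trans e∣d d∣a)

∣∧<⇒≡0 : ∀ {m n} → m ∣ n → n < m → n ≡ 0
∣∧<⇒≡0 {n = zero}  _   _   = refl
∣∧<⇒≡0 {n = suc n} m∣n n<m = contradiction (∣⇒≤ m∣n) (<⇒≱ n<m)

multiple-exists : ∀ {p n} .{{_ : NonZero p}} → Coprime n p → ∀ c → ∃ λ T → p ∣ c + T * n
multiple-exists {p@(suc p′)} {n} n⊥p c with coprime-Bézout n⊥p
... | Bézout.-+ x y 1+xn≡yp = c * x , divides (c * y) (begin
  c + c * x * n   ≡⟨ solve 3 (λ c x n → c :+ c :* x :* n := c :* (con 1 :+ x :* n)) refl c x n ⟩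
  c * (1 + x * n) ≡⟨ cong (c *_) 1+xn≡yp ⟩
  c * (y * p)     ≡⟨ sym (*-assoc c y p) ⟩
  c * y * p       ∎)
  where
  open ≡-Reasoning
  open +-*-Solver
... | Bézout.+- x y 1+yp≡xn = c * p′ * x , divides (c + c * p′ * y) (begin
  c + c * p′ * x * n      ≡⟨ solve 4 (λ c p′ x n → c :+ c :* p′ :* x :* n := c :+ c :* p′ :* (x :* n)) refl c p′ x n ⟩
  c + c * p′ * (x * n)    ≡⟨ cong (λ z → c + c * p′ * z) (sym 1+yp≡xn) ⟩
  c + c * p′ * (1 + y * p) ≡⟨ solve 3 (λ c p′ y → c :+ c :* p′ :* (con 1 :+ y :* (con 1 :+ p′))
                                                  := (c :+ c :* p′ :* y) :* (con 1 :+ p′)) refl c p′ y ⟩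
  (c + c * p′ * y) * p    ∎)
  where
  open ≡-Reasoning
  open +-*-Solver

module _ {p n : ℕ} .{{_ : NonZero p}} (p⊥n : Coprime p n) where

  private
    p∣-cancel : ∀ {c t o} → p ∣ c + t * n → p ∣ c + (t + o) * n → p ∣ o
    p∣-cancel {c} {t} {o} p∣c+tn p∣c+[t+o]n =
      coprime-divisor p⊥n (subst (p ∣_) (*-comm o n) (∣m+n∣m⇒∣n (subst (p ∣_) shift p∣c+[t+o]n) p∣c+tn))
      where
      shift : c + (t + o) * n ≡ c + t * n + o * n
      shift = trans (cong (c +_) (*-distribʳ-+ n t o)) (sym (+-assoc c (t * n) (o * n)))

    multiple-unique-≤ : ∀ {c t t′} → t ≤ t′ → t′ < p → p ∣ c + t * n → p ∣ c + t′ * n → t ≡ t′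
    multiple-unique-≤ {c} {t} t≤t′ t′<p p∣c+tn p∣c+t′n with m≤n⇒∃[o]m+o≡n t≤t′
    ... | o , refl = sym (trans (cong (t +_) o≡0) (+-identityʳ t))
      where
      o≡0 : o ≡ 0
      o≡0 = ∣∧<⇒≡0 (p∣-cancel {c} {t} p∣c+tn p∣c+t′n) (≤-<-trans (m≤n+m o t) t′<p)

  multiple-unique : ∀ {c t t′} → t < p → t′ < p → p ∣ c + t * n → p ∣ c + t′ * n → t ≡ t′
  multiple-unique {t = t} {t′} t<p t′<p p∣c+tn p∣c+t′n with ≤-total t t′
  ... | inj₁ t≤t′ = multiple-unique-≤ t≤t′ t′<p p∣c+tn p∣c+t′n
  ... | inj₂ t′≤t = sym (multiple-unique-≤ t′≤t t<p p∣c+t′n p∣c+tn)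

  multiple-exists-< : ∀ c → ∃ λ t → t < p × p ∣ c + t * n
  multiple-exists-< c with multiple-exists (coprime-sym p⊥n) c
  ... | T , p∣c+Tn = T % p , m%n<n T p , ∣m+n∣m⇒∣n (subst (p ∣_) split p∣c+Tn) (n∣m*n (T / p * n))
    where
    split : c + T * n ≡ T / p * n * p + (c + T % p * n)
    split = begin
      c + T * n                       ≡⟨ cong (λ z → c + z * n) (m≡m%n+[m/n]*n T p) ⟩
      c + (T % p + T / p * p) * n     ≡⟨ solve 5 (λ c r k p n → c :+ (r :+ k :* p) :* n := k :* n :* p :+ (c :+ r :* n))
                                                 refl c (T % p) (T / p) p n ⟩
      T / p * n * p + (c + T % p * n) ∎
      where
      open ≡-Reasoning
      open +-*-Solver

  ∑-𝟙-multiple≡1 : ∀ c → ∑[ t < p ] 𝟙 (p ∣? c + t * n) ≡ 1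
  ∑-𝟙-multiple≡1 c with multiple-exists-< c
  ... | t , t<p , p∣c+tn = ∑-𝟙-unique (λ t → p ∣? c + t * n) p multiple-unique t<p p∣c+tn

2∣n⊎2∣1+n : ∀ n → 2 ∣ n ⊎ 2 ∣ suc n
2∣n⊎2∣1+n zero    = inj₁ (divides 0 refl)
2∣n⊎2∣1+n (suc n) with 2∣n⊎2∣1+n n
... | inj₁ (divides k n≡k*2) = inj₂ (divides (suc k) (cong (suc ∘ suc) n≡k*2))
... | inj₂ 2∣1+n             = inj₁ 2∣1+n

coprimePair? : ∀ M g a → Dec (Coprime a M × Coprime (a + g) M)
coprimePair? M g a = coprime? a M ×-dec coprime? (a + g) M

pairCount : ℕ → ℕ → ℕ
pairCount N g = ∑[ x < N ] 𝟙 (coprimePair? N g (suc x))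

module _ (N : ℕ) where

  private
    P? : Decidable (λ a → Coprime a N)
    P? a = coprime? a N

  ∈-coprimeList⁺ : ∀ {a} → 0 < a → a ≤ suc N → Coprime a N → a ∈ coprimeList N
  ∈-coprimeList⁺ {suc a} _ (s≤s a≤N) = ∈-filter⁺ P? (∈-map⁺ suc (∈-upTo⁺ (s≤s a≤N)))

  ∈-coprimeList⁻ : ∀ {a} → a ∈ coprimeList N → a ≤ suc N × Coprime a N
  ∈-coprimeList⁻ a∈ with ∈-filter⁻ P? a∈
  ... | a∈L , a⊥N with ∈-map⁻ suc a∈L
  ...   | x , x∈ , refl = ∈-upTo⁻ x∈ , a⊥N

  suc-coprime : Coprime (suc N) N
  suc-coprime = subst (λ a → Coprime a N) (+-comm N 1) (coprime-+ (1-coprimeTo N))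

  coprimeList-sorted : AllPairs _<_ (coprimeList N)
  coprimeList-sorted = AllPairs.filter⁺ P?
    (subst (AllPairs _<_) (sym (map-upTo suc (suc N))) (AllPairs.applyUpTo⁺₁ suc (suc N) (λ i<j _ → s≤s i<j)))

  coprimeList-head : ∃ λ us → coprimeList N ≡ 1 ∷ us
  coprimeList-head = _ , filter-accept P? (1-coprimeTo N)

modOr≡% : ∀ m k .{{_ : NonZero k}} → modOr m k ≡ m % k
modOr≡% m (suc k) = refl

module CoprimeResidues (N : ℕ) (N>0 : 0 < N) where

  φ : ℕ
  φ = φ' N

  residue : ℕ → ℕ
  residue k = nth (coprimeList N) k

  length-coprimeList : length (coprimeList N) ≡ suc φ
  length-coprimeList with coprimeList-head N
  ... | us , eq = subst (λ vs → length vs ≡ suc (length (diffs vs))) (sym eq) (cong suc (sym (length-diffs 1 us)))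

  residue-0 : residue 0 ≡ 1
  residue-0 = cong (λ us → nth us 0) (proj₂ (coprimeList-head N))

  private
    ≤φ⇒<length : ∀ {k} → k ≤ φ → k < length (coprimeList N)
    ≤φ⇒<length k≤φ = subst (_ <_) (sym length-coprimeList) (s≤s k≤φ)

  residue-< : ∀ {i j} → i < j → j ≤ φ → residue i < residue j
  residue-< i<j j≤φ = nth-sorted (coprimeList-sorted N) i<j (≤φ⇒<length j≤φ)

  residue-≤∧coprime : ∀ {k} → k ≤ φ → residue k ≤ suc N × Coprime (residue k) N
  residue-≤∧coprime k≤φ = ∈-coprimeList⁻ N (nth-∈ (coprimeList N) (≤φ⇒<length k≤φ))

  residue-onto : ∀ {a} → 0 < a → a ≤ suc N → Coprime a N → ∃ λ k → k ≤ φ × residue k ≡ a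
  residue-onto 0<a a≤1+N a⊥N with ∈⇒nth (coprimeList N) (∈-coprimeList⁺ N 0<a a≤1+N a⊥N)
  ... | k , k<length , eq = k , ≤-pred (subst (k <_) length-coprimeList k<length) , eq

  residue-φ : residue φ ≡ suc N
  residue-φ with residue-onto (s≤s z≤n) ≤-refl (suc-coprime N)
  ... | k , k≤φ , eq with m≤n⇒m<n∨m≡n k≤φ
  ...   | inj₂ refl = eq
  ...   | inj₁ k<φ = contradiction (subst (_< residue φ) eq (residue-< k<φ ≤-refl)) (≤⇒≯ (proj₁ (residue-≤∧coprime ≤-refl)))

  0<φ : 0 < φ
  0<φ = n≢0⇒n>0 (λ φ≡0 → <⇒≢ N>0 (sym (suc-injective (trans (sym residue-φ) (trans (cong residue φ≡0) residue-0)))))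

  instance
    φ≢0 : NonZero φ
    φ≢0 = >-nonZero 0<φ

    N≢0 : NonZero N
    N≢0 = >-nonZero N>0

  gapAt≡ : ∀ m → gapAt N m ≡ residue (suc (m % φ)) ∸ residue (m % φ)
  gapAt≡ m = trans (cong (nth (gaps N)) (modOr≡% m φ)) (nth-diffs (coprimeList N) (m % φ))

  gapAt-+φ : ∀ m → gapAt N (m + φ) ≡ gapAt N m
  gapAt-+φ m = trans (gapAt≡ (m + φ)) (trans (cong (λ r → residue (suc r) ∸ residue r) ([m+n]%n≡m%n m φ)) (sym (gapAt≡ m)))

  gapAt-< : ∀ {k} → k < φ → gapAt N k ≡ residue (suc k) ∸ residue k
  gapAt-< {k} k<φ = trans (gapAt≡ k) (cong (λ r → residue (suc r) ∸ residue r) (m<n⇒m%n≡m k<φ))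

  -- residue k is the paper's u_k (k ≤ φ); u continues it by the cyclic gaps.
  u : ℕ → ℕ
  u zero    = 1
  u (suc m) = u m + gapAt N m

  u-residue : ∀ {k} → k ≤ φ → u k ≡ residue k
  u-residue {zero}  _       = sym residue-0
  u-residue {suc k} 1+k≤φ = begin
    u k + gapAt N k                           ≡⟨ cong₂ _+_ (u-residue (<⇒≤ 1+k≤φ)) (gapAt-< 1+k≤φ) ⟩
    residue k + (residue (suc k) ∸ residue k) ≡⟨ m+[n∸m]≡n (<⇒≤ (residue-< ≤-refl 1+k≤φ)) ⟩
    residue (suc k)                           ∎
    where open ≡-Reasoning

  u-+φ : ∀ m → u (m + φ) ≡ u m + N
  u-+φ zero    = trans (u-residue ≤-refl) residue-φ
  u-+φ (suc m) = begin
    u (m + φ) + gapAt N (m + φ) ≡⟨ cong₂ _+_ (u-+φ m) (gapAt-+φ m) ⟩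
    u m + N + gapAt N m         ≡⟨ xy∙z≈xz∙y (u m) N (gapAt N m) ⟩
    u m + gapAt N m + N         ∎
    where open ≡-Reasoning

  u-+*φ : ∀ m t → u (m + t * φ) ≡ u m + t * N
  u-+*φ m zero    = trans (cong u (+-identityʳ m)) (sym (+-identityʳ (u m)))
  u-+*φ m (suc t) = begin
    u (m + (φ + t * φ))   ≡⟨ cong u (x∙yz≈xz∙y m φ (t * φ)) ⟩
    u (m + t * φ + φ)     ≡⟨ u-+φ (m + t * φ) ⟩
    u (m + t * φ) + N     ≡⟨ cong (_+ N) (u-+*φ m t) ⟩
    u m + t * N + N       ≡⟨ xy∙z≈x∙zy (u m) (t * N) N ⟩
    u m + (N + t * N)     ∎
    where open ≡-Reasoning

  u-step : ∀ m → u m < u (suc m)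
  u-step m = m<m+n (u m) (subst (0 <_) (sym (gapAt≡ m)) (m<n⇒0<n∸m (residue-< ≤-refl (m%n<n m φ))))

  u-coprime : ∀ m → Coprime (u m) N
  u-coprime m = subst (λ a → Coprime a N) (sym u-m)
    (Equivalence.from (coprime-+-*⇔ (residue (m % φ)) (m / φ) N) (proj₂ (residue-≤∧coprime r≤φ)))
    where
    r≤φ : m % φ ≤ φ
    r≤φ = <⇒≤ (m%n<n m φ)
    u-m : u m ≡ residue (m % φ) + m / φ * N
    u-m = begin
      u m                        ≡⟨ cong u (m≡m%n+[m/n]*n m φ) ⟩
      u (m % φ + m / φ * φ)      ≡⟨ u-+*φ (m % φ) (m / φ) ⟩
      u (m % φ) + m / φ * N      ≡⟨ cong (_+ m / φ * N) (u-residue r≤φ) ⟩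
      residue (m % φ) + m / φ * N ∎
      where open ≡-Reasoning

  u-onto : ∀ a → 1 ≤ a → Coprime a N → ∃ λ m → u m ≡ a
  u-onto (suc a) _ a⊥N with residue-onto (s≤s z≤n) (s≤s (<⇒≤ (m%n<n a N))) r⊥N
    where
    a≡ : suc a ≡ suc (a % N) + a / N * N
    a≡ = cong suc (m≡m%n+[m/n]*n a N)
    r⊥N : Coprime (suc (a % N)) N
    r⊥N = Equivalence.to (coprime-+-*⇔ (suc (a % N)) (a / N) N) (subst (λ b → Coprime b N) a≡ a⊥N)
  ... | k , k≤φ , residue-k≡ = k + a / N * φ , (begin
    u (k + a / N * φ)          ≡⟨ u-+*φ k (a / N) ⟩
    u k + a / N * N            ≡⟨ cong (_+ a / N * N) (trans (u-residue k≤φ) residue-k≡) ⟩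
    suc (a % N) + a / N * N    ≡⟨ cong suc (sym (m≡m%n+[m/n]*n a N)) ⟩
    suc a                      ∎)
    where open ≡-Reasoning

  u-windowSum : ∀ i j → u i + windowSum N i j ≡ u (i + j)
  u-windowSum i j = trans (cong (u i +_) (sum-upTo j (λ k → gapAt N (i + k)))) (partial j)
    where
    partial : ∀ j → u i + ∑[ k < j ] gapAt N (i + k) ≡ u (i + j)
    partial zero    = trans (+-identityʳ (u i)) (cong u (sym (+-identityʳ i)))
    partial (suc j) = begin
      u i + (∑[ k < j ] gapAt N (i + k) + gapAt N (i + j)) ≡⟨ sym (+-assoc (u i) _ _) ⟩
      u i + ∑[ k < j ] gapAt N (i + k) + gapAt N (i + j)   ≡⟨ cong (_+ gapAt N (i + j)) (partial j) ⟩
      u (suc (i + j))                                      ≡⟨ cong u (sym (+-suc i j)) ⟩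
      u (i + suc j)                                        ∎
      where open ≡-Reasoning

  open StrictlyIncreasing u u-step

  windowSum≡⇔ : ∀ i j g → windowSum N i j ≡ g ⇔ u (i + j) ≡ u i + g
  windowSum≡⇔ i j g = mk⇔
    (λ w≡g → trans (sym (u-windowSum i j)) (cong (u i +_) w≡g))
    (λ u≡ → +-cancelˡ-≡ (u i) _ _ (trans (u-windowSum i j) u≡))

  ∑-𝟙-windowSum : ∀ i {g} → 0 < g → ∑[ j < g ] 𝟙 (windowSum N i (suc j) ≟ g) ≡ 𝟙 (coprime? (u i + g) N)
  ∑-𝟙-windowSum i {g} 0<g = begin
    ∑[ j < g ] 𝟙 (windowSum N i (suc j) ≟ g) ≡⟨ ∑-cong g (λ j _ → 𝟙-cong _ _ (windowSum≡⇔ i (suc j) g)) ⟩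
    ∑[ j < g ] 𝟙 (u (i + suc j) ≟ u i + g)   ≡⟨ ∑-hits≡𝟙-member (λ a → coprime? a N) u-coprime u-onto i 0<g ⟩
    𝟙 (coprime? (u i + g) N)                 ∎
    where open ≡-Reasoning

  ∑-nCount : ∀ {g} → 0 < g → ∑[ j < g ] nCount g (suc j) N ≡ ∑[ i < φ ] 𝟙 (coprime? (u i + g) N)
  ∑-nCount {g} 0<g = begin
    ∑[ j < g ] nCount g (suc j) N
      ≡⟨ ∑-cong g (λ j _ → length-filter-upTo (λ i → windowSum N i (suc j) ≟ g) φ) ⟩
    ∑[ j < g ] ∑[ i < φ ] 𝟙 (windowSum N i (suc j) ≟ g)
      ≡⟨ ∑-comm g φ (λ i j → 𝟙 (windowSum N i (suc j) ≟ g)) ⟩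
    ∑[ i < φ ] ∑[ j < g ] 𝟙 (windowSum N i (suc j) ≟ g)
      ≡⟨ ∑-cong φ (λ i _ → ∑-𝟙-windowSum i 0<g) ⟩
    ∑[ i < φ ] 𝟙 (coprime? (u i + g) N)
      ∎
    where open ≡-Reasoning

  module _ (2∣N : 2 ∣ N) where

    -- u m and u (suc m) are both odd.
    u-step-2 : ∀ m → 2 + u m ≤ u (suc m)
    u-step-2 m with m≤n⇒m<n∨m≡n (u-step m)
    ... | inj₁ 1+um<u1+m = 1+um<u1+m
    ... | inj₂ 1+um≡u1+m with 2∣n⊎2∣1+n (u m)
    ...   | inj₁ 2∣um   = contradiction 2∣um (coprime∧∣⇒∤ prime[2] 2∣N (u-coprime m))
    ...   | inj₂ 2∣1+um = contradiction (subst (2 ∣_) 1+um≡u1+m 2∣1+um) (coprime∧∣⇒∤ prime[2] 2∣N (u-coprime (suc m)))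

    windowSum-2≢2 : ∀ i → windowSum N i 2 ≢ 2
    windowSum-2≢2 i w≡2 = <-irrefl (sym (Equivalence.to (windowSum≡⇔ i 2 2) w≡2)) (begin-strict
      u i + 2           ≡⟨ +-comm (u i) 2 ⟩
      2 + u i           ≤⟨ u-step-2 i ⟩
      u (suc i)         <⟨ u-step (suc i) ⟩
      u (suc (suc i))   ≡⟨ cong u (sym (+-comm i 2)) ⟩
      u (i + 2)         ∎)
      where open ≤-Reasoning

    nCount-2-1 : nCount 2 1 N ≡ ∑[ i < φ ] 𝟙 (coprime? (u i + 2) N)
    nCount-2-1 = begin
      nCount 2 1 N                                 ≡⟨ length-filter-upTo (λ i → windowSum N i 1 ≟ 2) φ ⟩
      ∑[ i < φ ] 𝟙 (windowSum N i 1 ≟ 2)           ≡⟨ ∑-cong φ (λ i _ → sym (drop-window-2 i)) ⟩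
      ∑[ i < φ ] ∑[ j < 2 ] 𝟙 (windowSum N i (suc j) ≟ 2) ≡⟨ ∑-cong φ (λ i _ → ∑-𝟙-windowSum i (s≤s z≤n)) ⟩
      ∑[ i < φ ] 𝟙 (coprime? (u i + 2) N)          ∎
      where
      open ≡-Reasoning
      drop-window-2 : ∀ i → ∑[ j < 2 ] 𝟙 (windowSum N i (suc j) ≟ 2) ≡ 𝟙 (windowSum N i 1 ≟ 2)
      drop-window-2 i = trans (cong (𝟙 (windowSum N i 1 ≟ 2) +_) (𝟙-no (windowSum N i 2 ≟ 2) (windowSum-2≢2 i))) (+-identityʳ _)

  ∑-u≡pairCount : ∀ g → ∑[ i < φ ] 𝟙 (coprime? (u i + g) N) ≡ pairCount N g
  ∑-u≡pairCount g = +-cancelʳ-≡ (h (suc N)) _ _ (begin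
    ∑[ i < φ ] h (u i) + h (suc N)
      ≡⟨ cong₂ _+_ (∑-cong φ (λ i i<φ → cong h (u-residue (<⇒≤ i<φ)))) (cong h (sym residue-φ)) ⟩
    ∑[ i < suc φ ] h (residue i)
      ≡⟨ cong (λ n → ∑[ i < n ] h (residue i)) (sym length-coprimeList) ⟩
    ∑[ i < length (coprimeList N) ] h (residue i)
      ≡⟨ ∑-nth h (coprimeList N) ⟩
    sum (map h (coprimeList N))
      ≡⟨ sum-map-filter P? h (map suc (upTo (suc N))) ⟩
    sum (map (λ x → 𝟙 (P? x) * h x) (map suc (upTo (suc N))))
      ≡⟨ cong sum (sym (map-∘ (upTo (suc N)))) ⟩
    sum (map (λ x → 𝟙 (P? (suc x)) * h (suc x)) (upTo (suc N)))
      ≡⟨ sum-upTo (suc N) _ ⟩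
    ∑[ x < N ] (𝟙 (P? (suc x)) * h (suc x)) + 𝟙 (P? (suc N)) * h (suc N)
      ≡⟨ cong₂ _+_ (∑-cong N (λ x _ → sym (𝟙-× (P? (suc x)) (coprime? (suc x + g) N)))) last ⟩
    pairCount N g + h (suc N)
      ∎)
    where
    open ≡-Reasoning
    P? : Decidable (λ a → Coprime a N)
    P? a = coprime? a N
    h : ℕ → ℕ
    h y = 𝟙 (coprime? (y + g) N)
    last : 𝟙 (P? (suc N)) * h (suc N) ≡ h (suc N)
    last = trans (cong (_* h (suc N)) (𝟙-yes (P? (suc N)) (suc-coprime N))) (*-identityˡ (h (suc N)))

  sum-nCount≡pairCount : ∀ {g} → 0 < g → sum (map (λ j → nCount g (suc j) N) (upTo g)) ≡ pairCount N g
  sum-nCount≡pairCount {g} 0<g = trans (sum-upTo g _) (trans (∑-nCount 0<g) (∑-u≡pairCount g))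

  nCount-2-1≡pairCount : 2 ∣ N → nCount 2 1 N ≡ pairCount N 2
  nCount-2-1≡pairCount 2∣N = trans (nCount-2-1 2∣N) (∑-u≡pairCount 2)

𝟙-coprimePair-+ : ∀ M g a t N → 𝟙 (coprimePair? M g (a + t * N)) ≡ 𝟙 (coprime? (a + t * N) M) * 𝟙 (coprime? (a + g + t * N) M)
𝟙-coprimePair-+ M g a t N = trans (𝟙-× (coprime? (a + t * N) M) (coprime? (a + t * N + g) M))
  (cong (λ x → 𝟙 (coprime? (a + t * N) M) * 𝟙 (coprime? x M)) (xy∙z≈xz∙y a (t * N) g))

module _ {q N : ℕ} (q-prime : Prime q) where

  𝟙-coprime-*-+ : ∀ b t → 𝟙 (coprime? (b + t * N) (q * N)) ≡ 𝟙 (coprime? b N) * 𝟙 (¬? (q ∣? b + t * N))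
  𝟙-coprime-*-+ b t = begin
    𝟙 (coprime? (b + t * N) (q * N))
      ≡⟨ 𝟙-cong _ (coprime? (b + t * N) N ×-dec ¬? (q ∣? b + t * N)) (coprime-*⇔ q-prime) ⟩
    𝟙 (coprime? (b + t * N) N ×-dec ¬? (q ∣? b + t * N))
      ≡⟨ 𝟙-× (coprime? (b + t * N) N) (¬? (q ∣? b + t * N)) ⟩
    𝟙 (coprime? (b + t * N) N) * 𝟙 (¬? (q ∣? b + t * N))
      ≡⟨ cong (_* 𝟙 (¬? (q ∣? b + t * N))) (𝟙-cong (coprime? (b + t * N) N) (coprime? b N) (coprime-+-*⇔ b t N)) ⟩
    𝟙 (coprime? b N) * 𝟙 (¬? (q ∣? b + t * N))
      ∎
    where open ≡-Reasoning

  module _ (q∣N : q ∣ N) where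

    𝟙-coprime-*-+-∣ : ∀ b t → 𝟙 (coprime? (b + t * N) (q * N)) ≡ 𝟙 (coprime? b N)
    𝟙-coprime-*-+-∣ b t = 𝟙-cong _ _ (mk⇔ drop lift)
      where
      drop : Coprime (b + t * N) (q * N) → Coprime b N
      drop c = Equivalence.to (coprime-+-*⇔ b t N) (proj₁ (Equivalence.to (coprime-*⇔ q-prime) c))
      lift : Coprime b N → Coprime (b + t * N) (q * N)
      lift c = Equivalence.from (coprime-*⇔ q-prime) (c′ , coprime∧∣⇒∤ q-prime q∣N c′)
        where
        c′ : Coprime (b + t * N) N
        c′ = Equivalence.from (coprime-+-*⇔ b t N) c

    ∑-lift-∣ : ∀ g a → ∑[ t < q ] 𝟙 (coprimePair? (q * N) g (a + t * N)) ≡ q * 𝟙 (coprimePair? N g a)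
    ∑-lift-∣ g a = trans (∑-cong q (λ t _ → term t)) (∑-const q _)
      where
      term : ∀ t → 𝟙 (coprimePair? (q * N) g (a + t * N)) ≡ 𝟙 (coprimePair? N g a)
      term t = begin
        𝟙 (coprimePair? (q * N) g (a + t * N))
          ≡⟨ 𝟙-coprimePair-+ (q * N) g a t N ⟩
        𝟙 (coprime? (a + t * N) (q * N)) * 𝟙 (coprime? (a + g + t * N) (q * N))
          ≡⟨ cong₂ _*_ (𝟙-coprime-*-+-∣ a t) (𝟙-coprime-*-+-∣ (a + g) t) ⟩
        𝟙 (coprime? a N) * 𝟙 (coprime? (a + g) N)
          ≡⟨ sym (𝟙-× (coprime? a N) (coprime? (a + g) N)) ⟩
        𝟙 (coprimePair? N g a)
          ∎
        where open ≡-Reasoning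

  module _ (q∤N : ¬ q ∣ N) {g : ℕ} (q∤g : ¬ q ∣ g) where

    private
      instance
        q≢0 : NonZero q
        q≢0 = prime⇒nonZero q-prime

      q⊥N : Coprime q N
      q⊥N = prime∧∤⇒coprime q-prime q∤N

    avoids : ℕ → ℕ → ℕ
    avoids a t = 𝟙 (¬? (q ∣? a + t * N)) * 𝟙 (¬? (q ∣? a + g + t * N))

    ∑-avoids : ∀ a → ∑[ t < q ] avoids a t ≡ q ∸ 2
    ∑-avoids a = trans (sym (m+n∸n≡m (∑< q (avoids a)) 2)) (cong (_∸ 2) (begin
      ∑< q (avoids a) + 2
        ≡⟨ cong (∑< q (avoids a) +_) (sym (cong₂ _+_ (∑-𝟙-multiple≡1 q⊥N a) (∑-𝟙-multiple≡1 q⊥N (a + g)))) ⟩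
      ∑< q (avoids a) + (∑[ t < q ] 𝟙 (q ∣? a + t * N) + ∑[ t < q ] 𝟙 (q ∣? a + g + t * N))
        ≡⟨ cong (∑< q (avoids a) +_) (sym (∑-+ q _ _)) ⟩
      ∑< q (avoids a) + ∑[ t < q ] (𝟙 (q ∣? a + t * N) + 𝟙 (q ∣? a + g + t * N))
        ≡⟨ sym (∑-+ q (avoids a) _) ⟩
      ∑[ t < q ] (avoids a t + (𝟙 (q ∣? a + t * N) + 𝟙 (q ∣? a + g + t * N)))
        ≡⟨ ∑-cong q (λ t _ → partition t) ⟩
      ∑[ t < q ] 1
        ≡⟨ trans (∑-const q 1) (*-identityʳ q) ⟩
      q ∎))
      where
      open ≡-Reasoning
      partition : ∀ t → avoids a t + (𝟙 (q ∣? a + t * N) + 𝟙 (q ∣? a + g + t * N)) ≡ 1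
      partition t with q ∣? a + t * N | q ∣? a + g + t * N
      ... | yes q∣b | yes q∣b+g = contradiction (∣m+n∣m⇒∣n (subst (q ∣_) (xy∙z≈xz∙y a g (t * N)) q∣b+g) q∣b) q∤g
      ... | yes _   | no _      = refl
      ... | no _    | yes _     = refl
      ... | no _    | no _      = refl

    ∑-lift-∤ : ∀ a → ∑[ t < q ] 𝟙 (coprimePair? (q * N) g (a + t * N)) ≡ (q ∸ 2) * 𝟙 (coprimePair? N g a)
    ∑-lift-∤ a = begin
      ∑[ t < q ] 𝟙 (coprimePair? (q * N) g (a + t * N)) ≡⟨ ∑-cong q (λ t _ → term t) ⟩
      ∑[ t < q ] (𝟙 (coprimePair? N g a) * avoids a t)  ≡⟨ ∑-*ˡ q (𝟙 (coprimePair? N g a)) (avoids a) ⟩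
      𝟙 (coprimePair? N g a) * ∑< q (avoids a)          ≡⟨ cong (𝟙 (coprimePair? N g a) *_) (∑-avoids a) ⟩
      𝟙 (coprimePair? N g a) * (q ∸ 2)                  ≡⟨ *-comm _ (q ∸ 2) ⟩
      (q ∸ 2) * 𝟙 (coprimePair? N g a)                  ∎
      where
      open ≡-Reasoning
      term : ∀ t → 𝟙 (coprimePair? (q * N) g (a + t * N)) ≡ 𝟙 (coprimePair? N g a) * avoids a t
      term t = begin
        𝟙 (coprimePair? (q * N) g (a + t * N))
          ≡⟨ 𝟙-coprimePair-+ (q * N) g a t N ⟩
        𝟙 (coprime? (a + t * N) (q * N)) * 𝟙 (coprime? (a + g + t * N) (q * N))
          ≡⟨ cong₂ _*_ (𝟙-coprime-*-+ a t) (𝟙-coprime-*-+ (a + g) t) ⟩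
        (𝟙 (coprime? a N) * 𝟙 (¬? (q ∣? a + t * N))) * (𝟙 (coprime? (a + g) N) * 𝟙 (¬? (q ∣? a + g + t * N)))
          ≡⟨ *-interchange (𝟙 (coprime? a N)) (𝟙 (¬? (q ∣? a + t * N)))
                           (𝟙 (coprime? (a + g) N)) (𝟙 (¬? (q ∣? a + g + t * N))) ⟩
        𝟙 (coprime? a N) * 𝟙 (coprime? (a + g) N) * avoids a t
          ≡⟨ cong (_* avoids a t) (sym (𝟙-× (coprime? a N) (coprime? (a + g) N))) ⟩
        𝟙 (coprimePair? N g a) * avoids a t
          ∎

pairCount-* : ∀ {q N g} k → (∀ a → ∑[ t < q ] 𝟙 (coprimePair? (q * N) g (a + t * N)) ≡ k * 𝟙 (coprimePair? N g a)) →
  pairCount (q * N) g ≡ k * pairCount N g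
pairCount-* {q} {N} {g} k ∑-lift = begin
  ∑[ x < q * N ] 𝟙 (coprimePair? (q * N) g (suc x))
    ≡⟨ ∑-blocks q N _ ⟩
  ∑[ t < q ] ∑[ r < N ] 𝟙 (coprimePair? (q * N) g (suc (t * N + r)))
    ≡⟨ ∑-comm q N _ ⟩
  ∑[ r < N ] ∑[ t < q ] 𝟙 (coprimePair? (q * N) g (suc (t * N + r)))
    ≡⟨ ∑-cong N (λ r _ → ∑-cong q (λ t _ → cong (𝟙 ∘ coprimePair? (q * N) g) (cong suc (+-comm (t * N) r)))) ⟩
  ∑[ r < N ] ∑[ t < q ] 𝟙 (coprimePair? (q * N) g (suc r + t * N))
    ≡⟨ ∑-cong N (λ r _ → ∑-lift (suc r)) ⟩
  ∑[ r < N ] (k * 𝟙 (coprimePair? N g (suc r)))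
    ≡⟨ ∑-*ˡ N k _ ⟩
  k * pairCount N g
    ∎
  where open ≡-Reasoning

liftFactor : ℕ → ℕ → ℕ
liftFactor q N with q ∣? N
... | yes _ = q
... | no _  = q ∸ 2

pairCount-*-prime : ∀ {q N g} → Prime q → (¬ q ∣ N → ¬ q ∣ g) → pairCount (q * N) g ≡ liftFactor q N * pairCount N g
pairCount-*-prime {q} {N} {g} q-prime q∤N⇒q∤g with q ∣? N
... | yes q∣N = pairCount-* {q} {N} {g} q (∑-lift-∣ q-prime q∣N g)
... | no q∤N  = pairCount-* {q} {N} {g} (q ∸ 2) (∑-lift-∤ q-prime q∤N (q∤N⇒q∤g q∤N))

ratio : ℕ → ℕ → ℚ
ratio a zero    = ℚ.0ℚ
ratio a (suc d) = ℤ.+ a ℚ./ suc d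

wRatio≡ratio : ∀ g j N → wRatio g j N ≡ ratio (nCount g j N) (nCount 2 1 N)
wRatio≡ratio g j N with nCount 2 1 N
... | zero  = refl
... | suc d = refl

ratio-+ : ∀ a b d → ratio a d ℚ.+ ratio b d ≡ ratio (a + b) d
ratio-+ a b zero    = refl
ratio-+ a b (suc d) = ℚ.toℚᵘ-injective (begin
  ℚ.toℚᵘ (ratio a (suc d) ℚ.+ ratio b (suc d))
    ≈⟨ ℚ.toℚᵘ-homo-+ (ratio a (suc d)) (ratio b (suc d)) ⟩
  ℚ.toℚᵘ (ratio a (suc d)) ℚᵘ.+ ℚ.toℚᵘ (ratio b (suc d))
    ≈⟨ ℚᵘ.+-cong (ℚ.toℚᵘ-fromℚᵘ (mkℚᵘ A d)) (ℚ.toℚᵘ-fromℚᵘ (mkℚᵘ B d)) ⟩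
  mkℚᵘ A d ℚᵘ.+ mkℚᵘ B d
    ≈⟨ ℚᵘ.*≡* cross-multiplied ⟩
  mkℚᵘ (ℤ.+ (a + b)) d
    ≈⟨ ℚᵘ.≃-sym (ℚ.toℚᵘ-fromℚᵘ (mkℚᵘ (ℤ.+ (a + b)) d)) ⟩
  ℚ.toℚᵘ (ratio (a + b) (suc d))
    ∎)
  where
  open ℚᵘ.≃-Reasoning
  open ℤ-Solver.+-*-Solver
  A B D : ℤ
  A = ℤ.+ a
  B = ℤ.+ b
  D = ℤ.+ suc d
  cross-multiplied : (A ℤ.* D ℤ.+ B ℤ.* D) ℤ.* D ≡ ℤ.+ (a + b) ℤ.* ℤ.+ (suc d * suc d)
  cross-multiplied = trans
    (solve 3 (λ A B D → (A :* D :+ B :* D) :* D := (A :+ B) :* (D :* D)) refl A B D)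
    (sym (cong₂ ℤ._*_ (ℤ.pos-+ a b) (ℤ.pos-* (suc d) (suc d))))

ratio-0 : ∀ d → ratio 0 d ≡ ℚ.0ℚ
ratio-0 zero    = refl
ratio-0 (suc d) = ℚ.fromℚᵘ-cong (ℚᵘ.*≡* {mkℚᵘ (ℤ.+ 0) d} {mkℚᵘ (ℤ.+ 0) 0} refl)

foldr-ratio : ∀ (f : ℕ → ℕ) d xs → foldr ℚ._+_ ℚ.0ℚ (map (λ j → ratio (f j) d) xs) ≡ ratio (sum (map f xs)) d
foldr-ratio f d []       = sym (ratio-0 d)
foldr-ratio f d (x ∷ xs) = trans (cong (ratio (f x) d ℚ.+_) (foldr-ratio f d xs)) (ratio-+ (f x) _ d)

ratio-scale : ∀ {k} → 0 < k → ∀ a d → ratio (k * a) (k * d) ≡ ratio a d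
ratio-scale {suc k} _ a zero    = cong (ratio (suc k * a)) (*-zeroʳ (suc k))
ratio-scale {suc k} _ a (suc d) =
  ℚ.fromℚᵘ-cong (ℚᵘ.*≡* {mkℚᵘ (ℤ.+ (suc k * a)) (d + k * suc d)} {mkℚᵘ (ℤ.+ a) d} (begin
  ℤ.+ (suc k * a) ℤ.* ℤ.+ suc d   ≡⟨ sym (ℤ.pos-* (suc k * a) (suc d)) ⟩
  ℤ.+ (suc k * a * suc d)         ≡⟨ cong ℤ.+_ (trans (cong (_* suc d) (*-comm (suc k) a)) (*-assoc a (suc k) (suc d))) ⟩
  ℤ.+ (a * (suc k * suc d))       ≡⟨ ℤ.pos-* a (suc k * suc d) ⟩
  ℤ.+ a ℤ.* ℤ.+ (suc k * suc d)   ∎))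
  where open ≡-Reasoning

wTotal≡ratio : ∀ {N g} → 0 < N → 2 ∣ N → 0 < g → wTotal g N ≡ ratio (pairCount N g) (pairCount N 2)
wTotal≡ratio {N} {g} 0<N 2∣N 0<g = begin
  wTotal g N
    ≡⟨ cong (foldr ℚ._+_ ℚ.0ℚ) (map-cong (λ j → wRatio≡ratio g (suc j) N) (upTo g)) ⟩
  foldr ℚ._+_ ℚ.0ℚ (map (λ j → ratio (nCount g (suc j) N) (nCount 2 1 N)) (upTo g))
    ≡⟨ foldr-ratio (λ j → nCount g (suc j) N) (nCount 2 1 N) (upTo g) ⟩
  ratio (sum (map (λ j → nCount g (suc j) N) (upTo g))) (nCount 2 1 N)
    ≡⟨ cong₂ ratio (sum-nCount≡pairCount 0<g) (nCount-2-1≡pairCount 2∣N) ⟩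
  ratio (pairCount N g) (pairCount N 2)
    ∎
  where
  open ≡-Reasoning
  open CoprimeResidues N 0<N

liftFactor>0 : ∀ {q N} → Prime q → 2 ∣ N → 0 < liftFactor q N
liftFactor>0 {q} {N} q-prime 2∣N with q ∣? N
... | yes _   = <-trans (s≤s z≤n) (prime>1 q-prime)
... | no q∤N  = m<n⇒0<n∸m (≤∧≢⇒< (prime>1 q-prime) (λ 2≡q → q∤N (subst (_∣ N) 2≡q 2∣N)))

mainTheorem8 : (N g q : ℕ) → 0 < N → 2 ∣ N → 0 < g → 2 ∣ g → Prime q → ¬ (q ∣ g) →
    wTotal g (q * N) ≡ wTotal g N
mainTheorem8 N g q 0<N 2∣N 0<g _ q-prime q∤g = begin
  wTotal g (q * N)
    ≡⟨ wTotal≡ratio (m<n⇒m<o*n q {{prime⇒nonZero q-prime}} 0<N) (∣n⇒∣m*n q 2∣N) 0<g ⟩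
  ratio (pairCount (q * N) g) (pairCount (q * N) 2)
    ≡⟨ cong₂ ratio (pairCount-*-prime q-prime (λ _ → q∤g)) (pairCount-*-prime q-prime q∤N⇒q∤2) ⟩
  ratio (k * pairCount N g) (k * pairCount N 2)
    ≡⟨ ratio-scale (liftFactor>0 q-prime 2∣N) (pairCount N g) (pairCount N 2) ⟩
  ratio (pairCount N g) (pairCount N 2)
    ≡⟨ sym (wTotal≡ratio 0<N 2∣N 0<g) ⟩
  wTotal g N
    ∎
  where
  open ≡-Reasoning
  k : ℕ
  k = liftFactor q N
  q∤N⇒q∤2 : ¬ q ∣ N → ¬ q ∣ 2
  q∤N⇒q∤2 q∤N q∣2 = q∤N (∣-trans q∣2 2∣N)
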